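{- Let $\mathcal{P}$ be a class property such that every class in $\mathcal{P}$ has sublinear separators. If $\mathcal{G}$ is a fractionally $\mathcal{P}$-fragile class of graphs, then $\mathcal{G}$ has sublinear separators.
   Context: A class property is a class of graph classes. A separation of a graph $G$ is a pair $(A,B)$ of edge-disjoint subgraphs with $A\cup B=G$; its size is $|V(A)\cap V(B)|$; it is balanced if $|V(A)\setminus V(B)|\le2|V(G)|/3$ and $|V(B)\setminus V(A)|\le2|V(G)|/3$. For a class $\mathcal{C}$, $s_{\mathcal{C}}(n)$ is the smallest nonnegative integer such that every graph in $\mathcal{C}$ with at most $n$ vertices has a balanced separation of size at most $s_{\mathcal{C}}(n)$; $\mathcal{C}$ has sublinear separators if $\lim_{n\to\infty}s_{\mathcal{C}}(n)/n=0$. For a graph $G$ and class $\mathcal{C}$, let $G-\mathcal{C}=\{X\subseteq V(G):G-X\in\mathcal{C}\}$; a fractional $\mathcal{C}$-complementary packing in $G$ is a map $\pi:G-\mathcal{C}\to[0,1]$ with $\sum_X\pi(X)=1$, and its thickness is $\max_{v\in V(G)}\sum_{X\ni v}\pi(X)$. $\mathcal{G}$ is fractionally $\mathcal{P}$-fragile if for every $\varepsilon>0$ there exists $\mathcal{C}\in\mathcal{P}$ such that every graph in $\mathcal{G}$ has a fractional $\mathcal{C}$-complementary packing of thickness at most $\varepsilon$.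
   Formalization: The values of each fractional $\mathcal{C}$-complementary packing are rational, lying in [0,1] ∩ ℚ rather than [0,1], and every $\varepsilon$ ranges over the positive rationals. -}

module Defs where

open import Data.Bool using (Bool; true; false; _∧_; if_then_else_)
open import Data.Bool.Properties using (∧-comm; ∧-assoc)
open import Data.Nat as ℕ using (ℕ; _*_)
open import Data.Fin using (Fin)
open import Data.Fin.Subset using (Subset; _∈_; _⊆_; _∪_; _∩_; _─_; ∣_∣)
open import Data.Vec using (lookup)
open import Data.List using (List; map; foldr)
open import Data.List.Relation.Unary.All using (All)
open import Data.List.Relation.Unary.Unique.Propositional using (Unique)
open import Data.Integer using (+_)
open import Data.Rational using (ℚ; 0ℚ; 1ℚ; _+_; _≤_; _/_; Positive)
import Data.Rational as ℚ
open import Data.Product using (Σ; ∃; ∃-syntax; _×_; _,_; proj₁)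
open import Data.Sum using (_⊎_)
open import Relation.Binary.PropositionalEquality using (_≡_; refl; cong)

-- A graph lives on an ambient set Fin n; its
-- vertex set is V ⊆ Fin n and its (undirected, loopless) edge relation
-- is the symmetric Bool-valued relation adj, whose edges only join
-- vertices of V.

record Graph : Set where
  field
    n      : ℕ
    V      : Subset n
    adj    : Fin n → Fin n → Bool
    adj-sym : ∀ u v → adj u v ≡ adj v u
    irrefl : ∀ v → adj v v ≡ false
    closed : ∀ u v → adj u v ≡ true → lookup V u ≡ true

open Graph public

order : Graph → ℕ
order G = ∣ V G ∣

private
  ∧-true-r : ∀ a b → a ∧ b ≡ true → b ≡ true
  ∧-true-r true b p = p
  ∧-true-r false b ()

  ∧-true-l : ∀ a b → a ∧ b ≡ true → a ≡ true
  ∧-true-l true b p = refl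
  ∧-true-l false b ()

_⊖_ : (G : Graph) → Subset (n G) → Graph
G ⊖ X = record
  { n      = n G
  ; V      = W
  ; adj    = λ u v → adj G u v ∧ (lookup W u ∧ lookup W v)
  ; adj-sym = λ u v → symm u v
  ; irrefl = λ v → cong (_∧ (lookup W v ∧ lookup W v)) (irrefl G v)
  ; closed = λ u v p → ∧-true-l (lookup W u) (lookup W v)
                         (∧-true-r (adj G u v) _ p)
  }
  where
  W = V G ─ X
  symm : ∀ u v → adj G u v ∧ (lookup W u ∧ lookup W v)
               ≡ adj G v u ∧ (lookup W v ∧ lookup W u)
  symm u v rewrite adj-sym G u v | ∧-comm (lookup W u) (lookup W v) = refl

record Subgraph (G : Graph) : Set where
  field
    VS      : Subset (n G)
    ES      : Fin (n G) → Fin (n G) → Bool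
    VS⊆V    : VS ⊆ V G
    ES-sym  : ∀ u v → ES u v ≡ ES v u
    ES⊆E    : ∀ u v → ES u v ≡ true → adj G u v ≡ true
    ES-ends : ∀ u v → ES u v ≡ true → lookup VS u ≡ true

open Subgraph public

record Separation (G : Graph) : Set where
  field
    A        : Subgraph G
    B        : Subgraph G
    disjoint : ∀ u v → ES A u v ≡ true → ES B u v ≡ false
    coverV   : V G ⊆ VS A ∪ VS B
    coverE   : ∀ u v → adj G u v ≡ true → (ES A u v ≡ true) ⊎ (ES B u v ≡ true)

open Separation public

sepSize : {G : Graph} → Separation G → ℕ
sepSize S = ∣ VS (A S) ∩ VS (B S) ∣

Balanced : {G : Graph} → Separation G → Set
Balanced {G} S =
  (3 * ∣ VS (A S) ─ VS (B S) ∣ ℕ.≤ 2 * order G) ×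
  (3 * ∣ VS (B S) ─ VS (A S) ∣ ℕ.≤ 2 * order G)

GraphClass : Set₁
GraphClass = Graph → Set

ClassProperty : Set₁
ClassProperty = GraphClass → Set

_/1 : ℕ → ℚ
k /1 = + k / 1

-- lim_{n→∞} s_C(n)/n = 0, unfolded: for every ε > 0 there is N such that
-- for all n ≥ N, every graph in C with at most n vertices has a balanced
-- separation of size at most ε·n  (i.e. s_C(n) ≤ ε·n).
HasSublinearSeparators : GraphClass → Set
HasSublinearSeparators C =
  ∀ (ε : ℚ) → Positive ε →
  ∃[ N ] ∀ (m : ℕ) → N ℕ.≤ m →
    ∀ (G : Graph) → C G → order G ℕ.≤ m →
    Σ (Separation G) λ S → Balanced S × (sepSize S /1 ≤ ε ℚ.* (m /1))

-- Fractional C-complementary packings.  π : G - C → [0,1] is given by a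
-- finite list of (X , π X) pairs with pairwise distinct X ∈ G - C
-- (all other X get weight 0).

sumℚ : List ℚ → ℚ
sumℚ = foldr _+_ 0ℚ

InComplement : GraphClass → (G : Graph) → Subset (n G) → Set
InComplement C G X = (X ⊆ V G) × C (G ⊖ X)

record FracPacking (C : GraphClass) (G : Graph) : Set where
  field
    entries : List (Subset (n G) × ℚ)
    unique  : Unique (map proj₁ entries)
    inG-C   : All (λ e → InComplement C G (proj₁ e)) entries
    inUnit  : All (λ e → (0ℚ ≤ Data.Product.proj₂ e) × (Data.Product.proj₂ e ≤ 1ℚ)) entries
    total   : sumℚ (map Data.Product.proj₂ entries) ≡ 1ℚ

open FracPacking public

load : {C : GraphClass} {G : Graph} → FracPacking C G → Fin (n G) → ℚ
load π v = sumℚ (map (λ e → if lookup (proj₁ e) v then Data.Product.proj₂ e else 0ℚ) (entries π))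

ThicknessAtMost : {C : GraphClass} {G : Graph} → FracPacking C G → ℚ → Set
ThicknessAtMost {G = G} π ε = ∀ v → lookup (V G) v ≡ true → load π v ≤ ε

FractionallyFragile : ClassProperty → GraphClass → Set₁
FractionallyFragile P 𝒢 =
  ∀ (ε : ℚ) → Positive ε →
  Σ GraphClass λ C → P C ×
    (∀ (G : Graph) → 𝒢 G → Σ (FracPacking C G) λ π → ThicknessAtMost π ε)

-- Given ε, fragility with δ = ε/2 yields C ∈ 𝒫 such that every G ∈ 𝒢 carries a
-- fractional C-complementary packing π of thickness at most δ.  Double counting gives
-- Σ_X π(X)|X| = Σ_v Σ_{X∋v} π(X) ≤ δ|V(G)|, and as Σ_X π(X) = 1 the smallest X of the
-- support has |X| ≤ δ|V(G)|.  Since G − X ∈ C, for large m it has a balanced separation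
-- (A, B) of size at most δm.  Adding X to both sides, and each edge at X to A when both
-- its ends lie in V(A) ∪ X and to B otherwise, gives a separation of G that is still
-- balanced (nothing is added to V(A) ∖ V(B) or V(B) ∖ V(A)) and has size at most
-- δm + |X| ≤ εm.

module Submission where

open import Defs

open import Data.Bool using (Bool; true; false; _∧_; _∨_; not; if_then_else_)
open import Data.Bool.Properties using (∧-comm; ∨-comm; ∧-conicalˡ; ∧-conicalʳ; ∨-zeroʳ; ∧-zeroʳ)
open import Data.Nat as ℕ using (ℕ; zero; suc; z≤n; s≤s)
import Data.Nat.Properties as ℕ
import Data.Nat.Coprimality as Coprimality
import Data.Integer as ℤ
import Data.Integer.Properties as ℤ
open import Data.Fin using (Fin; zero; suc)
open import Data.Fin.Subset using (Subset; _∈_; _⊆_; _∪_; _∩_; _─_; ∣_∣)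
open import Data.Fin.Subset.Properties
  using (_∈?_; p⊆p∪q; q⊆p∪q; x∈p∪q⁻; x∈p∪q⁺; x∈p∧x∉q⇒x∈p─q; p─q⊆p; p⊆q⇒∣p∣≤∣q∣)
open import Data.Vec using (_∷_; []; lookup; here; there)
open import Data.Vec.Properties using (lookup⇒[]=; []=⇒lookup)
open import Data.List using (List; []; _∷_; map)
open import Data.List.Properties using (map-cong)
open import Data.List.Relation.Unary.All as All using (All; []; _∷_)
open import Data.List.Relation.Unary.Any using (here; there)
open import Data.List.Membership.Propositional using () renaming (_∈_ to _∈ₗ_)
open import Data.List.Extrema.Nat using (argmin; argmin-sel; f[argmin]≤f[⊤]; f[argmin]≤f[xs])
open import Data.Rational using (ℚ; 0ℚ; 1ℚ; _+_; _*_; _≤_; *≤*; ½; mkℚ; Positive; nonNegative)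
open import Data.Rational.Properties
open import Data.Product using (Σ; ∃-syntax; _×_; _,_; proj₁; proj₂)
open import Data.Sum using (_⊎_; inj₁; inj₂; [_,_]′)
import Data.Sum as Sum
open import Function using (_∘_)
open import Relation.Nullary using (¬_; yes; no; contradiction)
open import Relation.Binary.PropositionalEquality

open import Algebra.Properties.CommutativeMonoid.Sum +-0-commutativeMonoid
  using (sum; ∑-distrib-+; sum-replicate-zero)

/1≡mkℚ : ∀ k → k /1 ≡ mkℚ (ℤ.+ k) 0 (Coprimality.sym (Coprimality.1-coprimeTo k))
/1≡mkℚ k = normalize-coprime (Coprimality.sym (Coprimality.1-coprimeTo k))

/1-homo-+ : ∀ a b → (a ℕ.+ b) /1 ≡ a /1 + b /1
/1-homo-+ a b rewrite /1≡mkℚ a | /1≡mkℚ b =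
  sym (/-cong (cong₂ ℤ._+_ (ℤ.*-identityʳ (ℤ.+ a)) (ℤ.*-identityʳ (ℤ.+ b))) refl)

/1-mono-≤ : ∀ {a b} → a ℕ.≤ b → a /1 ≤ b /1
/1-mono-≤ {a} {b} a≤b rewrite /1≡mkℚ a | /1≡mkℚ b =
  *≤* (subst₂ ℤ._≤_ (sym (ℤ.*-identityʳ (ℤ.+ a))) (sym (ℤ.*-identityʳ (ℤ.+ b))) (ℤ.+≤+ a≤b))

p*½*q+p*½*q≡p*q : ∀ p q → p * ½ * q + p * ½ * q ≡ p * q
p*½*q+p*½*q≡p*q p q = begin
  p * ½ * q + p * ½ * q  ≡⟨ *-distribʳ-+ q (p * ½) (p * ½) ⟨
  (p * ½ + p * ½) * q    ≡⟨ cong (_* q) (*-distribˡ-+ p ½ ½) ⟨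
  p * 1ℚ * q             ≡⟨ cong (_* q) (*-identityʳ p) ⟩
  p * q                  ∎
  where open ≡-Reasoning

∨≡true⁻ : ∀ a {b} → a ∨ b ≡ true → a ≡ true ⊎ b ≡ true
∨≡true⁻ true  _ = inj₁ refl
∨≡true⁻ false e = inj₂ e

∨≡true⁺ˡ : ∀ {a} b → a ≡ true → a ∨ b ≡ true
∨≡true⁺ˡ b refl = refl

∨≡true⁺ʳ : ∀ a {b} → b ≡ true → a ∨ b ≡ true
∨≡true⁺ʳ a refl = ∨-zeroʳ a

⊆⇒lookup : ∀ {m} {p q : Subset m} → p ⊆ q → ∀ i → lookup p i ≡ true → lookup q i ≡ true
⊆⇒lookup {p = p} p⊆q i e = []=⇒lookup (p⊆q (lookup⇒[]= i p e))

∪─∪⊆─ : ∀ {m} (p q r : Subset m) → (p ∪ r) ─ (q ∪ r) ⊆ p ─ q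
∪─∪⊆─ (true  ∷ p) (false ∷ q) (false ∷ r)         here      = here
∪─∪⊆─ (false ∷ p) (false ∷ q) (false ∷ r) {zero}  ()
∪─∪⊆─ (_     ∷ p) (true  ∷ q) (_     ∷ r) {zero}  ()
∪─∪⊆─ (_     ∷ p) (false ∷ q) (true  ∷ r) {zero}  ()
∪─∪⊆─ (_     ∷ p) (_     ∷ q) (_     ∷ r)         (there i∈) = there (∪─∪⊆─ p q r i∈)

∪∩∪⊆∩∪ : ∀ {m} (p q r : Subset m) → (p ∪ r) ∩ (q ∪ r) ⊆ (p ∩ q) ∪ r
∪∩∪⊆∩∪ (true  ∷ p) (true  ∷ q) (false ∷ r)        here      = here
∪∩∪⊆∩∪ (p₀    ∷ p) (q₀    ∷ q) (true  ∷ r) {zero} _         = q⊆p∪q ((p₀ ∷ p) ∩ (q₀ ∷ q)) (true ∷ r) here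
∪∩∪⊆∩∪ (false ∷ p) (_     ∷ q) (false ∷ r) {zero} ()
∪∩∪⊆∩∪ (true  ∷ p) (false ∷ q) (false ∷ r) {zero} ()
∪∩∪⊆∩∪ (_     ∷ p) (_     ∷ q) (_     ∷ r)        (there i∈) = there (∪∩∪⊆∩∪ p q r i∈)

∣p∪q∣≤∣p∣+∣q∣ : ∀ {m} (p q : Subset m) → ∣ p ∪ q ∣ ℕ.≤ ∣ p ∣ ℕ.+ ∣ q ∣
∣p∪q∣≤∣p∣+∣q∣ []          []          = z≤n
∣p∪q∣≤∣p∣+∣q∣ (true  ∷ p) (true  ∷ q) = s≤s (ℕ.≤-trans (∣p∪q∣≤∣p∣+∣q∣ p q) (ℕ.+-monoʳ-≤ ∣ p ∣ (ℕ.n≤1+n ∣ q ∣)))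
∣p∪q∣≤∣p∣+∣q∣ (true  ∷ p) (false ∷ q) = s≤s (∣p∪q∣≤∣p∣+∣q∣ p q)
∣p∪q∣≤∣p∣+∣q∣ (false ∷ p) (true  ∷ q) rewrite ℕ.+-suc ∣ p ∣ ∣ q ∣ = s≤s (∣p∪q∣≤∣p∣+∣q∣ p q)
∣p∪q∣≤∣p∣+∣q∣ (false ∷ p) (false ∷ q) = ∣p∪q∣≤∣p∣+∣q∣ p q

lookup-─⁻ : ∀ {m} (p q : Subset m) i → lookup (p ─ q) i ≡ true → lookup q i ≡ false
lookup-─⁻ (_ ∷ p) (false ∷ q) zero    _ = refl
lookup-─⁻ (_ ∷ p) (true  ∷ q) zero    ()
lookup-─⁻ (_ ∷ p) (_     ∷ q) (suc i) e = lookup-─⁻ p q i e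

lookup-─⁺ : ∀ {m} (p q : Subset m) i → lookup p i ≡ true → lookup q i ≡ false → lookup (p ─ q) i ≡ true
lookup-─⁺ (_ ∷ p) (_ ∷ q) zero    refl refl = refl
lookup-─⁺ (_ ∷ p) (_ ∷ q) (suc i) e    e′   = lookup-─⁺ p q i e e′

∉⇒lookup≡false : ∀ {m} (p : Subset m) i → ¬ i ∈ p → lookup p i ≡ false
∉⇒lookup≡false p i i∉p with lookup p i in e
... | true  = contradiction (lookup⇒[]= i p e) i∉p
... | false = refl

module _ (G : Graph) (X : Subset (n G)) where

  ⊖-order-≤ : order (G ⊖ X) ℕ.≤ order G
  ⊖-order-≤ = p⊆q⇒∣p∣≤∣q∣ (p─q⊆p (V G) X)

  ⊖-adj⁻ : ∀ {u v} → adj (G ⊖ X) u v ≡ true →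
           adj G u v ≡ true × lookup X u ≡ false × lookup X v ≡ false
  ⊖-adj⁻ {u} {v} e =
    ∧-conicalˡ _ _ e , lookup-─⁻ (V G) X u (∧-conicalˡ _ _ both) , lookup-─⁻ (V G) X v (∧-conicalʳ _ _ both)
    where
    both : lookup (V G ─ X) u ∧ lookup (V G ─ X) v ≡ true
    both = ∧-conicalʳ (adj G u v) _ e

  ⊖-adj⁺ : ∀ {u v} → adj G u v ≡ true → lookup X u ≡ false → lookup X v ≡ false →
           adj (G ⊖ X) u v ≡ true
  ⊖-adj⁺ {u} {v} a xu xv
    rewrite a
          | lookup-─⁺ (V G) X u (closed G u v a) xu
          | lookup-─⁺ (V G) X v (closed G v u (trans (adj-sym G v u) a)) xv = refl

module Extension (G : Graph) (X : Subset (n G)) (X⊆V : X ⊆ V G) (S : Separation (G ⊖ X)) where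

  private
    SA = A S
    SB = B S

  VA VB : Subset (n G)
  VA = VS SA ∪ X
  VB = VS SB ∪ X

  touchesX : Fin (n G) → Fin (n G) → Bool
  touchesX u v = (lookup X u ∨ lookup X v) ∧ adj G u v

  EA EB : Fin (n G) → Fin (n G) → Bool
  EA u v = ES SA u v ∨ (touchesX u v ∧ (lookup VA u ∧ lookup VA v))
  EB u v = ES SB u v ∨ (touchesX u v ∧ not (lookup VA u ∧ lookup VA v))

  avoidsX : (H : Subgraph (G ⊖ X)) → ∀ {u v} → ES H u v ≡ true →
            adj G u v ≡ true × lookup X u ≡ false × lookup X v ≡ false
  avoidsX H {u} {v} e = ⊖-adj⁻ G X (ES⊆E H u v e)

  touchesX-sym : ∀ u v → touchesX u v ≡ touchesX v u
  touchesX-sym u v = cong₂ _∧_ (∨-comm (lookup X u) (lookup X v)) (adj-sym G u v)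

  touchesX⇒adj : ∀ {u v} → touchesX u v ≡ true → adj G u v ≡ true
  touchesX⇒adj = ∧-conicalʳ _ _

  touchesX-other : ∀ {u v} → lookup X u ≡ false → touchesX u v ≡ true → lookup X v ≡ true
  touchesX-other {u} {v} xu t = ∧-conicalˡ _ _ (subst (λ b → (b ∨ lookup X v) ∧ adj G u v ≡ true) xu t)

  ES⇒¬touchesX : (H : Subgraph (G ⊖ X)) → ∀ {u v} → ES H u v ≡ true → touchesX u v ≡ false
  ES⇒¬touchesX H e with avoidsX H e
  ... | _ , xu , xv rewrite xu | xv = refl

  ¬touchesX⇒avoidsX : ∀ {u v} → touchesX u v ≡ false → adj G u v ≡ true →
                      lookup X u ≡ false × lookup X v ≡ false
  ¬touchesX⇒avoidsX {u} {v} t a with lookup X u | lookup X v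
  ... | false | false = refl , refl
  ... | false | true  with () ← trans (sym a) t
  ... | true  | _     with () ← trans (sym a) t

  ∪X⊆V : (H : Subgraph (G ⊖ X)) → VS H ∪ X ⊆ V G
  ∪X⊆V H i∈ = [ p─q⊆p (V G) X ∘ VS⊆V H , X⊆V ]′ (x∈p∪q⁻ (VS H) X i∈)

  EA-ends : ∀ u v → EA u v ≡ true → lookup VA u ≡ true
  EA-ends u v e with ∨≡true⁻ (ES SA u v) e
  ... | inj₁ eA = ⊆⇒lookup (p⊆p∪q {p = VS SA} X) u (ES-ends SA u v eA)
  ... | inj₂ eX = ∧-conicalˡ _ _ (∧-conicalʳ (touchesX u v) _ eX)

  crossing-end-in-B : ∀ {u v} → lookup X u ≡ false → touchesX u v ≡ true →
                      not (lookup VA u ∧ lookup VA v) ≡ true → lookup VB u ≡ true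
  crossing-end-in-B {u} {v} xu t notBoth
    with x∈p∪q⁻ (VS SA) (VS SB)
           (coverV S (lookup⇒[]= u _ (lookup-─⁺ (V G) X u (closed G u v (touchesX⇒adj t)) xu)))
  ... | inj₂ u∈B = []=⇒lookup (p⊆p∪q X u∈B)
  ... | inj₁ u∈A
    -- v ∈ X, so with u ∈ A both ends lie in VA and the edge would belong to A′
    with () ← subst₂ (λ a b → not (a ∧ b) ≡ true)
                ([]=⇒lookup (p⊆p∪q X u∈A))
                (⊆⇒lookup (q⊆p∪q (VS SA) X) v (touchesX-other xu t))
                notBoth

  EB-ends : ∀ u v → EB u v ≡ true → lookup VB u ≡ true
  EB-ends u v e with ∨≡true⁻ (ES SB u v) e
  ... | inj₁ eB = ⊆⇒lookup (p⊆p∪q {p = VS SB} X) u (ES-ends SB u v eB)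
  ... | inj₂ eX with u ∈? X
  ...   | yes u∈X = []=⇒lookup (q⊆p∪q (VS SB) X u∈X)
  ...   | no  u∉X = crossing-end-in-B (∉⇒lookup≡false X u u∉X) (∧-conicalˡ _ _ eX) (∧-conicalʳ (touchesX u v) _ eX)

  A′ : Subgraph G
  A′ = record
    { VS      = VA
    ; ES      = EA
    ; VS⊆V    = ∪X⊆V SA
    ; ES-sym  = λ u v → cong₂ _∨_ (ES-sym SA u v)
                          (cong₂ _∧_ (touchesX-sym u v) (∧-comm (lookup VA u) (lookup VA v)))
    ; ES⊆E    = λ u v e → [ proj₁ ∘ avoidsX SA , touchesX⇒adj ∘ ∧-conicalˡ _ _ ]′ (∨≡true⁻ (ES SA u v) e)
    ; ES-ends = EA-ends
    }

  B′ : Subgraph G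
  B′ = record
    { VS      = VB
    ; ES      = EB
    ; VS⊆V    = ∪X⊆V SB
    ; ES-sym  = λ u v → cong₂ _∨_ (ES-sym SB u v)
                          (cong₂ _∧_ (touchesX-sym u v) (cong not (∧-comm (lookup VA u) (lookup VA v))))
    ; ES⊆E    = λ u v e → [ proj₁ ∘ avoidsX SB , touchesX⇒adj ∘ ∧-conicalˡ _ _ ]′ (∨≡true⁻ (ES SB u v) e)
    ; ES-ends = EB-ends
    }

  EA⇒¬EB : ∀ u v → EA u v ≡ true → EB u v ≡ false
  EA⇒¬EB u v e with ∨≡true⁻ (ES SA u v) e
  ... | inj₁ eA rewrite disjoint S u v eA | ES⇒¬touchesX SA eA = refl
  ... | inj₂ eX with ES SB u v in eB
  ...   | true  with () ← trans (sym (∧-conicalˡ _ _ eX)) (ES⇒¬touchesX SB eB)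
  ...   | false rewrite ∧-conicalʳ (touchesX u v) _ eX = ∧-zeroʳ (touchesX u v)

  cover-V : V G ⊆ VA ∪ VB
  cover-V {i} i∈V with i ∈? X
  ... | yes i∈X = p⊆p∪q VB (q⊆p∪q (VS SA) X i∈X)
  ... | no  i∉X = x∈p∪q⁺ (Sum.map (p⊆p∪q X) (p⊆p∪q X) (x∈p∪q⁻ (VS SA) (VS SB) (coverV S (x∈p∧x∉q⇒x∈p─q i∈V i∉X))))

  cover-E : ∀ u v → adj G u v ≡ true → EA u v ≡ true ⊎ EB u v ≡ true
  cover-E u v a with touchesX u v in t
  ... | true with lookup VA u ∧ lookup VA v
  ...   | true  = inj₁ (∨≡true⁺ʳ (ES SA u v) refl)
  ...   | false = inj₂ (∨≡true⁺ʳ (ES SB u v) refl)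
  cover-E u v a | false =
    Sum.map (∨≡true⁺ˡ _) (∨≡true⁺ˡ _) (coverE S u v (⊖-adj⁺ G X a (proj₁ avoid) (proj₂ avoid)))
    where avoid = ¬touchesX⇒avoidsX t a

  extended : Separation G
  extended = record { A = A′ ; B = B′ ; disjoint = EA⇒¬EB ; coverV = cover-V ; coverE = cover-E }

  extended-balanced : Balanced S → Balanced extended
  extended-balanced (balA , balB) =
    shrink (∪─∪⊆─ (VS SA) (VS SB) X) balA , shrink (∪─∪⊆─ (VS SB) (VS SA) X) balB
    where
    shrink : ∀ {P Q : Subset (n G)} → P ⊆ Q →
             3 ℕ.* ∣ Q ∣ ℕ.≤ 2 ℕ.* order (G ⊖ X) → 3 ℕ.* ∣ P ∣ ℕ.≤ 2 ℕ.* order G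
    shrink P⊆Q bal = ℕ.≤-trans (ℕ.*-monoʳ-≤ 3 (p⊆q⇒∣p∣≤∣q∣ P⊆Q))
                       (ℕ.≤-trans bal (ℕ.*-monoʳ-≤ 2 (⊖-order-≤ G X)))

  extended-size : sepSize extended ℕ.≤ sepSize S ℕ.+ ∣ X ∣
  extended-size = ℕ.≤-trans (p⊆q⇒∣p∣≤∣q∣ (∪∩∪⊆∩∪ (VS SA) (VS SB) X)) (∣p∪q∣≤∣p∣+∣q∣ (VS SA ∩ VS SB) X)

∑-mono-≤ : ∀ {m} {f g : Fin m → ℚ} → (∀ v → f v ≤ g v) → sum f ≤ sum g
∑-mono-≤ {zero}  f≤g = ≤-refl
∑-mono-≤ {suc m} f≤g = +-mono-≤ (f≤g zero) (∑-mono-≤ (f≤g ∘ suc))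

∑-indicator : ∀ {m} (Y : Subset m) c → sum (λ v → if lookup Y v then c else 0ℚ) ≡ c * (∣ Y ∣ /1)
∑-indicator []          c = sym (*-zeroʳ c)
∑-indicator (false ∷ Y) c = trans (+-identityˡ _) (∑-indicator Y c)
∑-indicator (true  ∷ Y) c = begin
  c + sum (λ v → if lookup Y v then c else 0ℚ)  ≡⟨ cong (c +_) (∑-indicator Y c) ⟩
  c + c * (∣ Y ∣ /1)                             ≡⟨ cong (_+ c * (∣ Y ∣ /1)) (*-identityʳ c) ⟨
  c * 1ℚ + c * (∣ Y ∣ /1)                        ≡⟨ *-distribˡ-+ c 1ℚ (∣ Y ∣ /1) ⟨
  c * (1ℚ + ∣ Y ∣ /1)                            ≡⟨ cong (c *_) (/1-homo-+ 1 ∣ Y ∣) ⟨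
  c * (suc ∣ Y ∣ /1)                             ∎
  where open ≡-Reasoning

∑-sumℚ-comm : ∀ {A : Set} {m} (h : Fin m → A → ℚ) (es : List A) →
              sum (λ v → sumℚ (map (h v) es)) ≡ sumℚ (map (λ e → sum (λ v → h v e)) es)
∑-sumℚ-comm {m = m} h []       = sum-replicate-zero m
∑-sumℚ-comm         h (e ∷ es) =
  trans (∑-distrib-+ (λ v → h v e) (λ v → sumℚ (map (h v) es)))
        (cong (sum (λ v → h v e) +_) (∑-sumℚ-comm h es))

weightedSize : ∀ {m} → List (Subset m × ℚ) → ℚ
weightedSize es = sumℚ (map (λ e → proj₂ e * (∣ proj₁ e ∣ /1)) es)

mass*k≤weightedSize : ∀ {m} k (es : List (Subset m × ℚ)) →
                      All (λ e → 0ℚ ≤ proj₂ e) es → All (λ e → k ℕ.≤ ∣ proj₁ e ∣) es →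
                      sumℚ (map proj₂ es) * (k /1) ≤ weightedSize es
mass*k≤weightedSize k []             []             []           = ≤-reflexive (*-zeroˡ (k /1))
mass*k≤weightedSize k ((Y , p) ∷ es) (0≤p ∷ nonneg) (k≤∣Y∣ ∷ ks) = begin
  (p + sumℚ (map proj₂ es)) * (k /1)          ≡⟨ *-distribʳ-+ (k /1) p _ ⟩
  p * (k /1) + sumℚ (map proj₂ es) * (k /1)   ≤⟨ +-mono-≤ (*-monoˡ-≤-nonNeg p {{nonNegative 0≤p}} (/1-mono-≤ k≤∣Y∣))
                                                          (mass*k≤weightedSize k es nonneg ks) ⟩
  p * (∣ Y ∣ /1) + weightedSize es             ∎
  where open ≤-Reasoning

lightest-entry : ∀ {m} (es : List (Subset m × ℚ)) →
                 All (λ e → 0ℚ ≤ proj₂ e) es → sumℚ (map proj₂ es) ≡ 1ℚ →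
                 Σ (Subset m × ℚ) λ e → e ∈ₗ es × ∣ proj₁ e ∣ /1 ≤ weightedSize es
lightest-entry []       _      ()
lightest-entry (e ∷ es) nonneg total = lightest , lightest∈ , (begin
  ∣ proj₁ lightest ∣ /1                                  ≡⟨ *-identityˡ _ ⟨
  1ℚ * (∣ proj₁ lightest ∣ /1)                           ≡⟨ cong (_* (∣ proj₁ lightest ∣ /1)) total ⟨
  sumℚ (map proj₂ (e ∷ es)) * (∣ proj₁ lightest ∣ /1)   ≤⟨ mass*k≤weightedSize _ (e ∷ es) nonneg
                                                              (f[argmin]≤f[⊤] {f = size} e es ∷ f[argmin]≤f[xs] {f = size} e es) ⟩
  weightedSize (e ∷ es)                                  ∎)
  where
  open ≤-Reasoning
  size : Subset _ × ℚ → ℕ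
  size = ∣_∣ ∘ proj₁
  lightest : Subset _ × ℚ
  lightest = argmin size e es
  lightest∈ : lightest ∈ₗ e ∷ es
  lightest∈ = [ here , there ]′ (argmin-sel size e es)

module _ {C : GraphClass} {G : Graph} (π : FracPacking C G) where

  ∑-load≡weightedSize : sum (load π) ≡ weightedSize (entries π)
  ∑-load≡weightedSize =
    trans (∑-sumℚ-comm (λ v e → if lookup (proj₁ e) v then proj₂ e else 0ℚ) (entries π))
          (cong sumℚ (map-cong (λ e → ∑-indicator (proj₁ e) (proj₂ e)) (entries π)))

  load-outside-V : ∀ v → lookup (V G) v ≡ false → load π v ≡ 0ℚ
  load-outside-V v v∉V = go (entries π) (inG-C π)
    where
    go : (es : List (Subset (n G) × ℚ)) → All (λ e → InComplement C G (proj₁ e)) es →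
         sumℚ (map (λ e → if lookup (proj₁ e) v then proj₂ e else 0ℚ) es) ≡ 0ℚ
    go []             []                 = refl
    go ((Y , p) ∷ es) ((Y⊆V , _) ∷ inGC) with lookup Y v in v∈Y
    ... | true  with () ← trans (sym (⊆⇒lookup Y⊆V v v∈Y)) v∉V
    ... | false = trans (+-identityˡ _) (go es inGC)

  thin⇒small-deletion-set : ∀ {δ} → ThicknessAtMost π δ →
                            ∃[ X ] InComplement C G X × ∣ X ∣ /1 ≤ δ * (order G /1)
  thin⇒small-deletion-set {δ} thin
    with lightest-entry (entries π) (All.map proj₁ (inUnit π)) (total π)
  ... | (Y , _) , Y∈ , Y≤ = Y , All.lookup (inG-C π) Y∈ , (begin
      ∣ Y ∣ /1                                        ≤⟨ Y≤ ⟩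
      weightedSize (entries π)                        ≡⟨ ∑-load≡weightedSize ⟨
      sum (load π)                                    ≤⟨ ∑-mono-≤ load≤ ⟩
      sum (λ v → if lookup (V G) v then δ else 0ℚ)    ≡⟨ ∑-indicator (V G) δ ⟩
      δ * (order G /1)                                ∎)
    where
    open ≤-Reasoning
    load≤ : ∀ v → load π v ≤ (if lookup (V G) v then δ else 0ℚ)
    load≤ v with lookup (V G) v in v∈V
    ... | true  = thin v v∈V
    ... | false = ≤-reflexive (load-outside-V v v∈V)

sum-within-halves : ∀ ε {a b k m} → a /1 ≤ ε * ½ * (m /1) → b /1 ≤ ε * ½ * (m /1) →
                    k ℕ.≤ a ℕ.+ b → k /1 ≤ ε * (m /1)
sum-within-halves ε {a} {b} {k} {m} a≤ b≤ k≤a+b = begin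
  k /1                                ≤⟨ /1-mono-≤ k≤a+b ⟩
  (a ℕ.+ b) /1                        ≡⟨ /1-homo-+ a b ⟩
  a /1 + b /1                         ≤⟨ +-mono-≤ a≤ b≤ ⟩
  ε * ½ * (m /1) + ε * ½ * (m /1)     ≡⟨ p*½*q+p*½*q≡p*q ε (m /1) ⟩
  ε * (m /1)                          ∎
  where open ≤-Reasoning

lemma15 : (P : ClassProperty) → (∀ C → P C → HasSublinearSeparators C) →
          (𝒢 : GraphClass) → FractionallyFragile P 𝒢 →
          HasSublinearSeparators 𝒢
lemma15 P sublinear 𝒢 fragile ε ε>0 =
  let (C , C∈P , thin-packings) = fragile δ δ>0
      (N , separators-of-C)     = sublinear C C∈P δ δ>0
  in N , λ m N≤m G G∈𝒢 ∣G∣≤m →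
    let (π , π-thin)              = thin-packings G G∈𝒢
        (X , (X⊆V , G⊖X∈C) , X≤) = thin⇒small-deletion-set π π-thin
        (S , S-balanced , S≤)     = separators-of-C m N≤m (G ⊖ X) G⊖X∈C (ℕ.≤-trans (⊖-order-≤ G X) ∣G∣≤m)
        open Extension G X X⊆V S
        X≤δm = ≤-trans X≤ (*-monoˡ-≤-nonNeg δ {{pos⇒nonNeg δ {{δ>0}}}} (/1-mono-≤ ∣G∣≤m))
    in extended , extended-balanced S-balanced ,
       sum-within-halves ε {a = sepSize S} {b = ∣ X ∣} {m = m} S≤ X≤δm extended-size
  where
  δ : ℚ
  δ = ε * ½
  δ>0 : Positive δ
  δ>0 = pos*pos⇒pos ε {{ε>0}} ½
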